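{- Let $M$ be a $2$TDS matrix and let $H$ be a component of $M$ of dimensions $x\times y$ (i.e. its ones meet exactly $x$ rows and $y$ columns of $M$). Then $H$ contains at least $x+y-1$ ones.
   Context: For an $n\times m$ $(0,1)$-matrix $M=(m_{ij})$, define $\kappa(i,j)$ as the $i$-th row sum plus the $j$-th column sum minus $2m_{ij}$; $M$ is a $k$TDS matrix if $\kappa(i,j)\geq k$ for all cells $(i,j)$. Given $M$, let $\Gamma(M)$ be the graph whose vertices are the positions of the ones of $M$, where two ones are adjacent iff they lie in the same row or the same column and no other one lies strictly between them in that row or column. The components of $M$ are the connected components of $\Gamma(M)$; a component is identified with the submatrix of $M$ on the rows and columns that its ones meet (this submatrix contains no ones of $M$ other than those of the component), and its dimensions are the numbers of such rows and columns. -}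

module Defs where

open import Data.Bool using (Bool; true; false; _∨_; if_then_else_)
open import Data.Nat using (ℕ; zero; suc; _+_; _*_; _∸_; _≤_)
open import Data.Fin using (Fin; _<_)
import Data.Fin as F
open import Data.Product using (_×_; _,_; ∃; proj₁; proj₂)
open import Data.Sum using (_⊎_)
open import Relation.Binary.PropositionalEquality using (_≡_)
open import Relation.Nullary using (¬_)
open import Relation.Binary.Construct.Closure.ReflexiveTransitive using (Star)
open import Function.Bundles using (_⇔_)

Matrix : ℕ → ℕ → Set
Matrix n m = Fin n → Fin m → Bool

val : Bool → ℕ
val true  = 1
val false = 0

count : ∀ {k} → (Fin k → Bool) → ℕ
count {zero}  f = 0
count {suc k} f = val (f F.zero) + count (λ i → f (F.suc i))

anyF : ∀ {k} → (Fin k → Bool) → Bool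
anyF {zero}  f = false
anyF {suc k} f = f F.zero ∨ anyF (λ i → f (F.suc i))

rowSum : ∀ {n m} → Matrix n m → Fin n → ℕ
rowSum M i = count (λ j → M i j)

colSum : ∀ {n m} → Matrix n m → Fin m → ℕ
colSum M j = count (λ i → M i j)

-- κ(i,j) = row sum + column sum − 2 m_ij  (always ≥ 0, so ∸ is exact)
κ : ∀ {n m} → Matrix n m → Fin n → Fin m → ℕ
κ M i j = rowSum M i + colSum M j ∸ 2 * val (M i j)

IsTDS : ℕ → ∀ {n m} → Matrix n m → Set
IsTDS k M = ∀ i j → k ≤ κ M i j

StrictlyBetween : ∀ {k} → Fin k → Fin k → Fin k → Set
StrictlyBetween a b c = (a < b × b < c) ⊎ (c < b × b < a)

Pos : ℕ → ℕ → Set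
Pos n m = Fin n × Fin m

Adj : ∀ {n m} → Matrix n m → Pos n m → Pos n m → Set
Adj M (i , j) (i' , j') =
  M i j ≡ true × M i' j' ≡ true × ¬ ((i , j) ≡ (i' , j')) ×
  ( (i ≡ i' × (∀ l → StrictlyBetween j l j' → M i l ≡ false))
  ⊎ (j ≡ j' × (∀ l → StrictlyBetween i l i' → M l j ≡ false)) )

IsComponent : ∀ {n m} → Matrix n m → (Fin n → Fin m → Bool) → Set
IsComponent {n} {m} M C =
  ∃ λ (p : Pos n m) → M (proj₁ p) (proj₂ p) ≡ true ×
    (∀ i j → (C i j ≡ true) ⇔ Star (Adj M) p (i , j))

sumF : ∀ {k} → (Fin k → ℕ) → ℕ
sumF {zero}  f = 0
sumF {suc k} f = f F.zero + sumF (λ i → f (F.suc i))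

numOnes : ∀ {n m} → (Fin n → Fin m → Bool) → ℕ
numOnes C = sumF (λ i → count (C i))

numRows : ∀ {n m} → (Fin n → Fin m → Bool) → ℕ
numRows C = count (λ i → anyF (C i))

numCols : ∀ {n m} → (Fin n → Fin m → Bool) → ℕ
numCols C = count (λ j → anyF (λ i → C i j))

-- Build the component from one of its
-- ones by repeatedly adding a one adjacent to the part built so far.  Each
-- added one shares a row or a column with an earlier one, so it brings at
-- most one new line, while the first one brings two; hence throughout
-- rows + columns ≤ ones + 1 (a spanning-tree count).
module Submission where

open import Defs
open import Algebra.Bundles using (CommutativeMonoid)
import Algebra.Properties.CommutativeSemigroup as CommutativeSemigroupProperties
open import Data.Bool using (Bool; true; false; _∨_; _∧_)
open import Data.Bool.Properties
  using (∨-identityʳ; ∨-zeroʳ; ∧-identityʳ; ∧-comm; ∨-commutativeMonoid)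
  renaming (_≟_ to _≟ᵇ_)
open import Data.Empty using (⊥-elim)
open import Data.Fin using (Fin; zero; suc; _≟_)
open import Data.Fin.Properties using (any?)
open import Data.Nat using (ℕ; zero; suc; _+_; _∸_; _≤_; z≤n; s≤s)
open import Data.Nat.Properties hiding (_≟_)
open import Data.Product using (_×_; _,_; ∃; ∃₂; proj₁; proj₂)
open import Data.Sum using (_⊎_; inj₁; inj₂)
open import Function using (_∘_)
open import Function.Bundles using (_⇔_; Equivalence)
open import Level using (Level)
open import Relation.Binary.Core using (Rel)
open import Relation.Binary.Construct.Closure.ReflexiveTransitive using (Star; ε; _◅_)
open import Relation.Binary.PropositionalEquality
open import Relation.Nullary.Decidable using (does; yes; no; dec-true; _×-dec_)

private variable
  k n m : ℕ

⁅_⁆ : Fin k → Fin k → Bool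
⁅ a ⁆ i = does (i ≟ a)

_∪_ : (Fin k → Bool) → (Fin k → Bool) → Fin k → Bool
(f ∪ g) i = f i ∨ g i

count-cong : {f g : Fin k → Bool} → f ≗ g → count f ≡ count g
count-cong {zero}  f≗g = refl
count-cong {suc k} f≗g = cong₂ _+_ (cong val (f≗g zero)) (count-cong (f≗g ∘ suc))

anyF-cong : {f g : Fin k → Bool} → f ≗ g → anyF f ≡ anyF g
anyF-cong {zero}  f≗g = refl
anyF-cong {suc k} f≗g = cong₂ _∨_ (f≗g zero) (anyF-cong (f≗g ∘ suc))

sumF-cong : {f g : Fin k → ℕ} → f ≗ g → sumF f ≡ sumF g
sumF-cong {zero}  f≗g = refl
sumF-cong {suc k} f≗g = cong₂ _+_ (f≗g zero) (sumF-cong (f≗g ∘ suc))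

val-mono : ∀ {a b} → (a ≡ true → b ≡ true) → val a ≤ val b
val-mono {false} a⇒b = z≤n
val-mono {true}  a⇒b rewrite a⇒b refl = ≤-refl

count-mono : {f g : Fin k → Bool} → (∀ i → f i ≡ true → g i ≡ true) → count f ≤ count g
count-mono {zero}  f⇒g = z≤n
count-mono {suc k} f⇒g = +-mono-≤ (val-mono (f⇒g zero)) (count-mono (f⇒g ∘ suc))

sumF-mono : {f g : Fin k → ℕ} → (∀ i → f i ≤ g i) → sumF f ≤ sumF g
sumF-mono {zero}  f≤g = z≤n
sumF-mono {suc k} f≤g = +-mono-≤ (f≤g zero) (sumF-mono (f≤g ∘ suc))

count-none : (f : Fin k → Bool) → (∀ i → f i ≡ false) → count f ≡ 0
count-none {zero}  f none = refl
count-none {suc k} f none rewrite none zero = count-none (f ∘ suc) (none ∘ suc)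

anyF-none : (f : Fin k → Bool) → (∀ i → f i ≡ false) → anyF f ≡ false
anyF-none {zero}  f none = refl
anyF-none {suc k} f none rewrite none zero = anyF-none (f ∘ suc) (none ∘ suc)

sumF-zeros : (f : Fin k → ℕ) → (∀ i → f i ≡ 0) → sumF f ≡ 0
sumF-zeros {zero}  f zeros = refl
sumF-zeros {suc k} f zeros rewrite zeros zero = sumF-zeros (f ∘ suc) (zeros ∘ suc)

sumF-+ : (f g : Fin k → ℕ) → sumF (λ i → f i + g i) ≡ sumF f + sumF g
sumF-+ {zero}  f g = refl
sumF-+ {suc k} f g = begin
  (f zero + g zero) + sumF (λ i → f (suc i) + g (suc i))
    ≡⟨ cong ((f zero + g zero) +_) (sumF-+ (f ∘ suc) (g ∘ suc)) ⟩
  (f zero + g zero) + (sumF (f ∘ suc) + sumF (g ∘ suc))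
    ≡⟨ +-interchange (f zero) (g zero) _ _ ⟩
  (f zero + sumF (f ∘ suc)) + (g zero + sumF (g ∘ suc)) ∎
  where
  open ≡-Reasoning
  open CommutativeSemigroupProperties +-commutativeSemigroup
    using () renaming (interchange to +-interchange)

sumF-val : (f : Fin k → Bool) → sumF (val ∘ f) ≡ count f
sumF-val {zero}  f = refl
sumF-val {suc k} f = cong (val (f zero) +_) (sumF-val (f ∘ suc))

count-⁅⁆ : (a : Fin k) → count ⁅ a ⁆ ≡ 1
count-⁅⁆ {suc k} zero = cong ℕ.suc (count-none (⁅ Fin.zero {k} ⁆ ∘ suc) λ _ → refl)
count-⁅⁆ (suc a)      = count-⁅⁆ a

count-∪-⁅⁆-fresh : (f : Fin k → Bool) (a : Fin k) → f a ≡ false →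
  count (f ∪ ⁅ a ⁆) ≡ suc (count f)
count-∪-⁅⁆-fresh f zero fa rewrite fa = cong ℕ.suc (count-cong (∨-identityʳ ∘ f ∘ suc))
count-∪-⁅⁆-fresh f (suc a) fa = begin
  val (f zero ∨ false) + count ((f ∘ suc) ∪ ⁅ a ⁆)
    ≡⟨ cong₂ _+_ (cong val (∨-identityʳ (f zero))) (count-∪-⁅⁆-fresh (f ∘ suc) a fa) ⟩
  val (f zero) + suc (count (f ∘ suc))
    ≡⟨ +-suc (val (f zero)) _ ⟩
  suc (count f) ∎
  where open ≡-Reasoning

count-∪-⁅⁆-present : (f : Fin k → Bool) (a : Fin k) → f a ≡ true →
  count (f ∪ ⁅ a ⁆) ≡ count f
count-∪-⁅⁆-present f a fa = count-cong pointwise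
  where
  pointwise : f ∪ ⁅ a ⁆ ≗ f
  pointwise i with i ≟ a
  ... | yes refl rewrite fa = refl
  ... | no _ = ∨-identityʳ (f i)

count-∪-⁅⁆-≤ : (f : Fin k → Bool) (a : Fin k) → count (f ∪ ⁅ a ⁆) ≤ suc (count f)
count-∪-⁅⁆-≤ f a with f a in fa
... | true  = ≤-trans (≤-reflexive (count-∪-⁅⁆-present f a fa)) (n≤1+n _)
... | false = ≤-reflexive (count-∪-⁅⁆-fresh f a fa)

anyF-∪ : (f g : Fin k → Bool) → anyF (f ∪ g) ≡ anyF f ∨ anyF g
anyF-∪ {zero}  f g = refl
anyF-∪ {suc k} f g = begin
  (f zero ∨ g zero) ∨ anyF ((f ∘ suc) ∪ (g ∘ suc))
    ≡⟨ cong ((f zero ∨ g zero) ∨_) (anyF-∪ (f ∘ suc) (g ∘ suc)) ⟩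
  (f zero ∨ g zero) ∨ (anyF (f ∘ suc) ∨ anyF (g ∘ suc))
    ≡⟨ ∨-interchange (f zero) (g zero) _ _ ⟩
  (f zero ∨ anyF (f ∘ suc)) ∨ (g zero ∨ anyF (g ∘ suc)) ∎
  where
  open ≡-Reasoning
  open CommutativeSemigroupProperties (CommutativeMonoid.commutativeSemigroup ∨-commutativeMonoid)
    using () renaming (interchange to ∨-interchange)

anyF-∧ˡ : (c : Bool) (f : Fin k → Bool) → anyF (λ i → c ∧ f i) ≡ c ∧ anyF f
anyF-∧ˡ true  f = refl
anyF-∧ˡ false f = anyF-none (λ i → false ∧ f i) λ _ → refl

anyF-⁅⁆ : (a : Fin k) → anyF ⁅ a ⁆ ≡ true
anyF-⁅⁆ zero    = refl
anyF-⁅⁆ (suc a) = anyF-⁅⁆ a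

anyF-witness : (f : Fin k → Bool) (i : Fin k) → f i ≡ true → anyF f ≡ true
anyF-witness f zero    fi rewrite fi = refl
anyF-witness f (suc i) fi =
  trans (cong (f zero ∨_) (anyF-witness (f ∘ suc) i fi)) (∨-zeroʳ (f zero))

Region : ℕ → ℕ → Set
Region n m = Fin n → Fin m → Bool

_∋_ : Region n m → Pos n m → Bool
S ∋ (i , j) = S i j

_⊆_ : Region n m → Region n m → Set
S ⊆ T = ∀ i j → S i j ≡ true → T i j ≡ true

∅ : Region n m
∅ _ _ = false

_⊕_ : Region n m → Pos n m → Region n m
(S ⊕ (a , b)) i j = S i j ∨ (⁅ a ⁆ i ∧ ⁅ b ⁆ j)

occupiedRows : Region n m → Fin n → Bool
occupiedRows S i = anyF (S i)

occupiedCols : Region n m → Fin m → Bool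
occupiedCols S j = anyF (λ i → S i j)

OnOccupiedLine : Region n m → Pos n m → Set
OnOccupiedLine S (a , b) = (∃ λ b′ → S a b′ ≡ true) ⊎ (∃ λ a′ → S a′ b ≡ true)

FewLines : Region n m → Set
FewLines S = numRows S + numCols S ≤ suc (numOnes S)

∅-⊆ : {S : Region n m} → ∅ ⊆ S
∅-⊆ _ _ ()

⊆-⊕ : {S : Region n m} (u : Pos n m) → S ⊆ (S ⊕ u)
⊆-⊕ _ i j Sij rewrite Sij = refl

⊕-∋ : (S : Region n m) (u : Pos n m) → (S ⊕ u) ∋ u ≡ true
⊕-∋ S (a , b) rewrite dec-true (a ≟ a) refl | dec-true (b ≟ b) refl = ∨-zeroʳ (S a b)

⊕-⊆ : {S T : Region n m} {u : Pos n m} → S ⊆ T → T ∋ u ≡ true → (S ⊕ u) ⊆ T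
⊕-⊆ {S = S} {u = a , b} S⊆T Tu i j S⊕uij with S i j in Sij
... | true = S⊆T i j Sij
... | false with i ≟ a | j ≟ b | S⊕uij
...   | yes refl | yes refl | _ = Tu

⊆-antisym : {S T : Region n m} → S ⊆ T → T ⊆ S → ∀ i j → S i j ≡ T i j
⊆-antisym {S = S} {T} S⊆T T⊆S i j with S i j in Sij | T i j in Tij
... | true  | true  = refl
... | false | false = refl
... | true  | false = trans (sym (S⊆T i j Sij)) Tij
... | false | true  = trans (sym Sij) (T⊆S i j Tij)

numRows-∅ : ∀ n m → numRows (∅ {n} {m}) ≡ 0
numRows-∅ n m = count-none (occupiedRows (∅ {n} {m})) λ i → anyF-none (∅ {n} {m} i) λ _ → refl

numCols-∅ : ∀ n m → numCols (∅ {n} {m}) ≡ 0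
numCols-∅ n m = count-none (occupiedCols (∅ {n} {m})) λ j → anyF-none (λ i → ∅ {n} {m} i j) λ _ → refl

numOnes-∅ : ∀ n m → numOnes (∅ {n} {m}) ≡ 0
numOnes-∅ n m = sumF-zeros (λ i → count (∅ {n} {m} i)) λ i → count-none (∅ {n} {m} i) λ _ → refl

numOnes-mono : {S T : Region n m} → S ⊆ T → numOnes S ≤ numOnes T
numOnes-mono S⊆T = sumF-mono λ i → count-mono (S⊆T i)

FewLines-cong : {S T : Region n m} → (∀ i j → S i j ≡ T i j) → FewLines S → FewLines T
FewLines-cong S≡T = subst₂ (λ lines ones → lines ≤ suc ones) (cong₂ _+_ rows cols) ones
  where
  rows = count-cong λ i → anyF-cong (S≡T i)
  cols = count-cong λ j → anyF-cong λ i → S≡T i j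
  ones = sumF-cong λ i → count-cong (S≡T i)

occupiedRows-⊕ : (S : Region n m) (a : Fin n) (b : Fin m) →
  occupiedRows (S ⊕ (a , b)) ≗ occupiedRows S ∪ ⁅ a ⁆
occupiedRows-⊕ S a b i = begin
  anyF (λ j → S i j ∨ (⁅ a ⁆ i ∧ ⁅ b ⁆ j)) ≡⟨ anyF-∪ (S i) _ ⟩
  anyF (S i) ∨ anyF (λ j → ⁅ a ⁆ i ∧ ⁅ b ⁆ j)
    ≡⟨ cong (anyF (S i) ∨_) (trans (anyF-∧ˡ (⁅ a ⁆ i) ⁅ b ⁆) (cong (⁅ a ⁆ i ∧_) (anyF-⁅⁆ b))) ⟩
  anyF (S i) ∨ (⁅ a ⁆ i ∧ true)            ≡⟨ cong (anyF (S i) ∨_) (∧-identityʳ (⁅ a ⁆ i)) ⟩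
  anyF (S i) ∨ ⁅ a ⁆ i                     ∎
  where open ≡-Reasoning

occupiedCols-⊕ : (S : Region n m) (a : Fin n) (b : Fin m) →
  occupiedCols (S ⊕ (a , b)) ≗ occupiedCols S ∪ ⁅ b ⁆
occupiedCols-⊕ S a b j = begin
  anyF (λ i → S i j ∨ (⁅ a ⁆ i ∧ ⁅ b ⁆ j)) ≡⟨ anyF-∪ (λ i → S i j) _ ⟩
  occupiedCols S j ∨ anyF (λ i → ⁅ a ⁆ i ∧ ⁅ b ⁆ j)
    ≡⟨ cong (occupiedCols S j ∨_) (anyF-cong λ i → ∧-comm (⁅ a ⁆ i) (⁅ b ⁆ j)) ⟩
  occupiedCols S j ∨ anyF (λ i → ⁅ b ⁆ j ∧ ⁅ a ⁆ i)
    ≡⟨ cong (occupiedCols S j ∨_) (trans (anyF-∧ˡ (⁅ b ⁆ j) ⁅ a ⁆) (cong (⁅ b ⁆ j ∧_) (anyF-⁅⁆ a))) ⟩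
  occupiedCols S j ∨ (⁅ b ⁆ j ∧ true)      ≡⟨ cong (occupiedCols S j ∨_) (∧-identityʳ (⁅ b ⁆ j)) ⟩
  occupiedCols S j ∨ ⁅ b ⁆ j               ∎
  where open ≡-Reasoning

numRows-⊕-≤ : (S : Region n m) (a : Fin n) (b : Fin m) → numRows (S ⊕ (a , b)) ≤ suc (numRows S)
numRows-⊕-≤ S a b =
  ≤-trans (≤-reflexive (count-cong (occupiedRows-⊕ S a b))) (count-∪-⁅⁆-≤ (occupiedRows S) a)

numCols-⊕-≤ : (S : Region n m) (a : Fin n) (b : Fin m) → numCols (S ⊕ (a , b)) ≤ suc (numCols S)
numCols-⊕-≤ S a b =
  ≤-trans (≤-reflexive (count-cong (occupiedCols-⊕ S a b))) (count-∪-⁅⁆-≤ (occupiedCols S) b)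

numRows-⊕-occupied : (S : Region n m) (a : Fin n) (b b′ : Fin m) → S a b′ ≡ true →
  numRows (S ⊕ (a , b)) ≡ numRows S
numRows-⊕-occupied S a b b′ Sab′ = trans (count-cong (occupiedRows-⊕ S a b))
  (count-∪-⁅⁆-present (occupiedRows S) a (anyF-witness (S a) b′ Sab′))

numCols-⊕-occupied : (S : Region n m) (a a′ : Fin n) (b : Fin m) → S a′ b ≡ true →
  numCols (S ⊕ (a , b)) ≡ numCols S
numCols-⊕-occupied S a a′ b Sa′b = trans (count-cong (occupiedCols-⊕ S a b))
  (count-∪-⁅⁆-present (occupiedCols S) b (anyF-witness (λ i → S i b) a′ Sa′b))

numOnes-⊕-fresh : (S : Region n m) (a : Fin n) (b : Fin m) → S a b ≡ false →
  numOnes (S ⊕ (a , b)) ≡ suc (numOnes S)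
numOnes-⊕-fresh S a b Sab = begin
  numOnes (S ⊕ (a , b))                          ≡⟨ sumF-cong rowCount ⟩
  sumF (λ i → count (S i) + val (⁅ a ⁆ i))     ≡⟨ sumF-+ (λ i → count (S i)) (val ∘ ⁅ a ⁆) ⟩
  numOnes S + sumF (val ∘ ⁅ a ⁆)               ≡⟨ cong (numOnes S +_) (trans (sumF-val ⁅ a ⁆) (count-⁅⁆ a)) ⟩
  numOnes S + 1                                  ≡⟨ +-comm (numOnes S) 1 ⟩
  suc (numOnes S)                                ∎
  where
  open ≡-Reasoning
  rowCount : (λ i → count ((S ⊕ (a , b)) i)) ≗ (λ i → count (S i) + val (⁅ a ⁆ i))
  rowCount i with i ≟ a
  ... | yes refl = trans (count-∪-⁅⁆-fresh (S a) b Sab) (+-comm 1 _)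
  ... | no _     = trans (count-cong (∨-identityʳ ∘ S i)) (sym (+-identityʳ _))

FewLines-singleton : (u : Pos n m) → FewLines (∅ ⊕ u)
FewLines-singleton {n} {m} (a , b) = begin
  numRows (∅ ⊕ (a , b)) + numCols (∅ ⊕ (a , b))
    ≤⟨ +-mono-≤ (numRows-⊕-≤ ∅ a b) (numCols-⊕-≤ ∅ a b) ⟩
  suc (numRows (∅ {n} {m})) + suc (numCols (∅ {n} {m}))
    ≡⟨ cong₂ (λ r c → suc r + suc c) (numRows-∅ n m) (numCols-∅ n m) ⟩
  2
    ≡⟨ cong ℕ.suc (sym (trans (numOnes-⊕-fresh ∅ a b refl) (cong ℕ.suc (numOnes-∅ n m)))) ⟩
  suc (numOnes (∅ ⊕ (a , b)))         ∎
  where open ≤-Reasoning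

FewLines-⊕ : (S : Region n m) (a : Fin n) (b : Fin m) → FewLines S → S a b ≡ false →
  OnOccupiedLine S (a , b) → FewLines (S ⊕ (a , b))
FewLines-⊕ S a b few Sab sharesLine = begin
  numRows (S ⊕ (a , b)) + numCols (S ⊕ (a , b)) ≤⟨ newLine sharesLine ⟩
  suc (numRows S + numCols S)                    ≤⟨ s≤s few ⟩
  suc (suc (numOnes S))                          ≡⟨ cong ℕ.suc (sym (numOnes-⊕-fresh S a b Sab)) ⟩
  suc (numOnes (S ⊕ (a , b)))                    ∎
  where
  open ≤-Reasoning
  newLine : OnOccupiedLine S (a , b) →
    numRows (S ⊕ (a , b)) + numCols (S ⊕ (a , b)) ≤ suc (numRows S + numCols S)
  newLine (inj₁ (b′ , Sab′)) rewrite numRows-⊕-occupied S a b b′ Sab′ =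
    ≤-trans (+-monoʳ-≤ (numRows S) (numCols-⊕-≤ S a b)) (≤-reflexive (+-suc _ _))
  newLine (inj₂ (a′ , Sa′b)) rewrite numCols-⊕-occupied S a a′ b Sa′b =
    +-monoˡ-≤ (numCols S) (numRows-⊕-≤ S a b)

Star-exit : {ℓ r : Level} {A : Set ℓ} {R : Rel A r} (P : A → Bool) {x y : A} →
  Star R x y → P x ≡ true → P y ≡ false →
  ∃₂ λ u v → R u v × P u ≡ true × P v ≡ false × Star R x v
Star-exit P ε Px Py with trans (sym Px) Py
... | ()
Star-exit P {x} (_◅_ {j = z} xz zy) Px Py with P z in Pz
... | true  with Star-exit P zy Pz Py
...   | u , v , uv , Pu , Pv , zv = u , v , uv , Pu , Pv , xz ◅ zv
Star-exit P {x} (_◅_ {j = z} xz zy) Px Py | false = x , z , xz , Px , Pz , xz ◅ ε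

module Connected {n m : ℕ} {r : Level} {R : Rel (Pos n m) r}
  (R-collinear : ∀ {u v} → R u v → proj₁ u ≡ proj₁ v ⊎ proj₂ u ≡ proj₂ v)
  (H : Region n m) (p : Pos n m)
  (H-reach : ∀ i j → (H i j ≡ true) ⇔ Star R p (i , j)) where

  frontier : (S : Region n m) → S ⊆ H → S ∋ p ≡ true →
    H ⊆ S ⊎ ∃₂ λ u v → R u v × S ∋ u ≡ true × S ∋ v ≡ false × H ∋ v ≡ true
  frontier S S⊆H Sp with any? (λ i → any? λ j → (H i j ≟ᵇ true) ×-dec (S i j ≟ᵇ false))
  ... | yes (i , j , Hij , Sij) with Star-exit (S ∋_) (Equivalence.to (H-reach i j) Hij) Sp Sij
  ...   | u , v@(a , b) , uv , Su , Sv , pv = inj₂ (u , v , uv , Su , Sv , Equivalence.from (H-reach a b) pv)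
  frontier S S⊆H Sp | no H⊈S = inj₁ H⊆S
    where
    H⊆S : H ⊆ S
    H⊆S i j Hij with S i j in Sij
    ... | true  = refl
    ... | false = ⊥-elim (H⊈S (i , j , Hij , Sij))

  grow : (k : ℕ) (S : Region n m) → S ⊆ H → S ∋ p ≡ true → FewLines S →
    numOnes H ≤ k + numOnes S → FewLines H
  grow k S S⊆H Sp few bound with frontier S S⊆H Sp
  ... | inj₁ H⊆S = FewLines-cong (⊆-antisym S⊆H H⊆S) few
  ... | inj₂ ((a′ , b′) , (a , b) , uv , Su , Sv , Hv) = step k bound
    where
    S′ = S ⊕ (a , b)
    S′⊆H : S′ ⊆ H
    S′⊆H = ⊕-⊆ S⊆H Hv
    sharesLine : OnOccupiedLine S (a , b)
    sharesLine with R-collinear uv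
    ... | inj₁ refl = inj₁ (b′ , Su)
    ... | inj₂ refl = inj₂ (a′ , Su)
    ones′ : numOnes S′ ≡ suc (numOnes S)
    ones′ = numOnes-⊕-fresh S a b Sv
    step : (k : ℕ) → numOnes H ≤ k + numOnes S → FewLines H
    step zero    bound′ = ⊥-elim (<⇒≱ (≤-trans (≤-reflexive (sym ones′)) (numOnes-mono S′⊆H)) bound′)
    step (suc k) bound′ =
      grow k S′ S′⊆H (⊆-⊕ {S = S} (a , b) (proj₁ p) (proj₂ p) Sp) (FewLines-⊕ S a b few Sv sharesLine)
        (≤-trans bound′ (≤-reflexive (trans (sym (+-suc k _)) (cong (k +_) (sym ones′)))))

  FewLines-connected : FewLines H
  FewLines-connected =
    grow (numOnes H) (∅ ⊕ p) (⊕-⊆ ∅-⊆ (Equivalence.from (H-reach _ _) ε)) (⊕-∋ ∅ p)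
      (FewLines-singleton p) (m≤m+n _ _)

Adj-collinear : (M : Matrix n m) {u v : Pos n m} → Adj M u v → proj₁ u ≡ proj₁ v ⊎ proj₂ u ≡ proj₂ v
Adj-collinear M {_ , _} {_ , _} (_ , _ , _ , inj₁ (sameRow , _)) = inj₁ sameRow
Adj-collinear M {_ , _} {_ , _} (_ , _ , _ , inj₂ (sameCol , _)) = inj₂ sameCol

lemma8 : ∀ {n m} (M : Matrix n m) → IsTDS 2 M →
    (H : Fin n → Fin m → Bool) → IsComponent M H →
    numRows H + numCols H ∸ 1 ≤ numOnes H
lemma8 M _ H (p , _ , H-reach) =
  ∸-monoˡ-≤ 1 (Connected.FewLines-connected (Adj-collinear M) H p H-reach)
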